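{- Let $k\ge 3$ and $0\le m\le p_{k+1}-3$ be integers. 1. Let $q$ be the smallest prime with $q\ge p_{k+1}-m$. Then \[\frac{p_{k+1}}{q}\le G(p_k,m)\le\frac{p_{k+1}}{p_{k+1}-m}.\] 2. For every $F\in\mathcal{G}(p_k,m)$, \[G(p_k,m)\ge F\ge 1+\frac{\ell(F)}{p_k}.\]
   Context: $p_i$ denotes the $i$-th prime. For $k\ge3$ and an integer $0\le m\le p_{k+1}-3$, $\mathcal{G}(p_k,m)$ is the set of fractions $F=\frac{Q_1Q_2\cdots Q_s}{q_1q_2\cdots q_s}$ with $s\ge 0$ and primes $3\le q_s<q_{s-1}<\dots<q_1\le p_k<p_{k+1}\le Q_1<\dots<Q_s$ satisfying $\ell(F):=\sum_{i=1}^s(Q_i-q_i)\le m$ (the case $s=0$ gives $F=1$, $\ell(F)=0$). $G(p_k,m)=\max_{F\in\mathcal{G}(p_k,m)}F$. -}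

module Defs where

open import Data.Nat using (ℕ; zero; suc; _+_; _∸_; _≤_; _<_; _>_)
open import Data.Nat.Primality using (Prime; prime?)
open import Data.Integer using (+_)
open import Data.Rational using (ℚ; _/_; 0ℚ)
open import Data.List using (List; length; filter; upTo)
open import Data.Nat.ListAction using (sum; product)
open import Data.List.Relation.Unary.All using (All)
open import Data.List.Relation.Unary.Linked using (Linked)
open import Data.Product using (Σ; _×_; ∃₂)
open import Relation.Binary.PropositionalEquality using (_≡_)

primesBelow : ℕ → ℕ
primesBelow n = length (filter prime? (upTo n))

-- p is the i-th prime p_i (1-indexed: p_1 = 2)
IsNthPrime : ℕ → ℕ → Set
IsNthPrime i p = Prime p × suc (primesBelow p) ≡ i

-- the rational number a / b (only used with b > 0; b = 0 gives 0 by convention)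
frac : ℕ → ℕ → ℚ
frac a zero    = 0ℚ
frac a (suc b) = (+ a) / suc b

-- F = (Q_1⋯Q_s)/(q_1⋯q_s), given by the lists Qs = [Q_1,…,Q_s], qs = [q_1,…,q_s]
value : List ℕ → List ℕ → ℚ
value Qs qs = frac (product Qs) (product qs)

-- ℓ(F) = Σ (Q_i − q_i) = Σ Q_i − Σ q_i  (exact since Q_i > q_i for members)
ell : List ℕ → List ℕ → ℕ
ell Qs qs = sum Qs ∸ sum qs

-- (Qs, qs) represents an element of 𝒢(p_k, m), where pk = p_k, pk1 = p_{k+1}
InG : ℕ → ℕ → ℕ → List ℕ → List ℕ → Set
InG pk pk1 m Qs qs =
  length Qs ≡ length qs
  × All Prime qs × All (3 ≤_) qs × All (_≤ pk) qs × Linked _>_ qs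
  × All Prime Qs × All (pk1 ≤_) Qs × Linked _<_ Qs
  × ell Qs qs ≤ m

IsMaxG : ℕ → ℕ → ℕ → ℚ → Set
IsMaxG pk pk1 m G =
  (∃₂ λ Qs qs → InG pk pk1 m Qs qs × value Qs qs ≡ G)
  × (∀ Qs qs → InG pk pk1 m Qs qs → value Qs qs Data.Rational.≤ G)

SmallestPrimeAtLeast : ℕ → ℕ → Set
SmallestPrimeAtLeast n q = Prime q × n ≤ q × (∀ r → Prime r → n ≤ r → q ≤ r)

-- Write a factor Q/q of F as (q + d)/q, where q ≤ p_k < p_{k+1} ≤ Q. Then
-- 1 + d/p_k ≤ Q/q ≤ p_{k+1}/(p_{k+1} − d), and both bounds survive taking products, since
-- (1 + x/a)(1 + y/a) ≥ 1 + (x + y)/a and b/(b − x) · b/(b − y) ≤ b/(b − x − y). Induction over the factors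
-- thus gives 1 + ℓ(F)/p_k ≤ F ≤ p_{k+1}/(p_{k+1} − ℓ(F)) ≤ p_{k+1}/(p_{k+1} − m). For the lower bound on G:
-- a prime q < p_{k+1} is at most p_k, so p_{k+1}/q is itself in 𝒢(p_k, m) when p_{k+1} − q ≤ m.
{-# OPTIONS --safe #-}
module Submission where

open import Defs
open import Data.Nat using (ℕ; suc; _+_; _∸_; _*_; _≤_; _<_; _≤′_; ≤′-refl; ≤′-step; z≤n; s≤s; _<?_; >-nonZero⁻¹)
open import Data.Nat.Properties
open import Data.Nat.Primality using (Prime; prime?; prime⇒nonZero; productOfPrimes≥1)
open import Data.Nat.ListAction using (sum; product)
import Algebra.Properties.CommutativeSemigroup as CommSemigroupProperties
import Data.Integer as ℤ
import Data.Integer.Properties as ℤ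
open import Data.Rational using (ℚ; 1ℚ; toℚᵘ) renaming (_≤_ to _≤ℚ_; _+_ to _+ℚ_)
import Data.Rational.Properties as ℚ
import Data.Rational.Unnormalised as ℚᵘ
import Data.Rational.Unnormalised.Properties as ℚᵘ
open import Data.List using (List; []; _∷_; [_]; _++_; length; filter; upTo)
open import Data.List.Properties using (upTo-∷ʳ; length-++; filter-++)
open import Data.List.Relation.Binary.Pointwise using (Pointwise; []; _∷_)
open import Data.List.Relation.Unary.All using (All; []; _∷_)
open import Data.List.Relation.Unary.Linked using ([]; [-])
open import Data.Product using (_×_; _,_)
open import Data.Empty using (⊥-elim)
open import Function using (_∘_)
open import Relation.Nullary using (yes; no)
open import Relation.Binary.PropositionalEquality
  using (_≡_; refl; sym; trans; cong; cong₂; subst; subst₂; module ≡-Reasoning)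

private
  module + = CommSemigroupProperties +-commutativeSemigroup
  module * = CommSemigroupProperties *-commutativeSemigroup

toℚᵘ-frac : ∀ a b → toℚᵘ (frac a (suc b)) ℚᵘ.≃ ℚᵘ.mkℚᵘ (ℤ.+ a) b
toℚᵘ-frac a b = ℚ.toℚᵘ-fromℚᵘ (ℚᵘ.mkℚᵘ (ℤ.+ a) b)

cross-≤⇒frac-≤ : ∀ {a b c d} → 0 < b → 0 < d → a * d ≤ c * b → frac a b ≤ℚ frac c d
cross-≤⇒frac-≤ {a} {suc b} {c} {suc d} _ _ ad≤cb = ℚ.toℚᵘ-cancel-≤
  (ℚᵘ.≤-respˡ-≃ (ℚᵘ.≃-sym (toℚᵘ-frac a b)) (ℚᵘ.≤-respʳ-≃ (ℚᵘ.≃-sym (toℚᵘ-frac c d))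
    (ℚᵘ.*≤* (subst₂ ℤ._≤_ (ℤ.pos-* a (suc d)) (ℤ.pos-* c (suc b)) (ℤ.+≤+ ad≤cb)))))

1+frac≡frac : ∀ l n → 0 < n → 1ℚ +ℚ frac l n ≡ frac (n + l) n
1+frac≡frac l (suc n) _ = ℚ.toℚᵘ-injective (begin-equality
  toℚᵘ (1ℚ +ℚ frac l (suc n))                 ≃⟨ ℚ.toℚᵘ-homo-+ 1ℚ (frac l (suc n)) ⟩
  ℚᵘ.1ℚᵘ ℚᵘ.+ toℚᵘ (frac l (suc n))          ≃⟨ ℚᵘ.+-congʳ ℚᵘ.1ℚᵘ (toℚᵘ-frac l n) ⟩
  ℚᵘ.1ℚᵘ ℚᵘ.+ ℚᵘ.mkℚᵘ (ℤ.+ l) n              ≃⟨ ℚᵘ.*≡* (cong₂ ℤ._*_ numerator denominator) ⟩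
  ℚᵘ.mkℚᵘ (ℤ.+ (suc n + l)) n                 ≃⟨ ℚᵘ.≃-sym (toℚᵘ-frac (suc n + l) n) ⟩
  toℚᵘ (frac (suc n + l) (suc n))             ∎)
  where
  open ℚᵘ.≤-Reasoning
  numerator : ℤ.1ℤ ℤ.* ℤ.+ suc n ℤ.+ ℤ.+ l ℤ.* ℤ.1ℤ ≡ ℤ.+ (suc n + l)
  numerator = trans (cong₂ ℤ._+_ (ℤ.*-identityˡ (ℤ.+ suc n)) (ℤ.*-identityʳ (ℤ.+ l))) (sym (ℤ.pos-+ (suc n) l))
  denominator : ℤ.+ suc n ≡ ℤ.+ suc (n + 0)
  denominator = cong (λ x → ℤ.+ suc x) (sym (+-identityʳ n))

[m+o]*n≤m*[n+o] : ∀ {m n} o → n ≤ m → (m + o) * n ≤ m * (n + o)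
[m+o]*n≤m*[n+o] {m} {n} o n≤m = begin
  (m + o) * n    ≡⟨ *-distribʳ-+ n m o ⟩
  m * n + o * n  ≤⟨ +-monoʳ-≤ (m * n) (*-monoʳ-≤ o n≤m) ⟩
  m * n + o * m  ≡⟨ cong (m * n +_) (*-comm o m) ⟩
  m * n + m * o  ≡⟨ *-distribˡ-+ m n o ⟨
  m * (n + o)    ∎
  where open ≤-Reasoning

[m∸o]*[n+o]≤m*n : ∀ {m n} o → m ≤ n + o → (m ∸ o) * (n + o) ≤ m * n
[m∸o]*[n+o]≤m*n {m} {n} o m≤n+o = begin
  (m ∸ o) * (n + o)                  ≡⟨ *-distribʳ-∸ (n + o) m o ⟩
  m * (n + o) ∸ o * (n + o)          ≡⟨ cong (_∸ o * (n + o)) (*-distribˡ-+ m n o) ⟩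
  m * n + m * o ∸ o * (n + o)        ≤⟨ ∸-monoˡ-≤ (o * (n + o)) (+-monoʳ-≤ (m * n) mo≤o[n+o]) ⟩
  m * n + o * (n + o) ∸ o * (n + o)  ≡⟨ m+n∸n≡m (m * n) (o * (n + o)) ⟩
  m * n                              ∎
  where
  open ≤-Reasoning
  mo≤o[n+o] : m * o ≤ o * (n + o)
  mo≤o[n+o] = subst (m * o ≤_) (*-comm (n + o) o) (*-monoˡ-≤ o m≤n+o)

ell-∷ : ∀ q d {Qs qs} → sum qs ≤ sum Qs → ell (q + d ∷ Qs) (q ∷ qs) ≡ d + ell Qs qs
ell-∷ q d {Qs} {qs} Σqs≤ΣQs = begin
  q + d + sum Qs ∸ (q + sum qs)    ≡⟨ cong (_∸ (q + sum qs)) (+-assoc q d (sum Qs)) ⟩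
  q + (d + sum Qs) ∸ (q + sum qs)  ≡⟨ [m+n]∸[m+o]≡n∸o q (d + sum Qs) (sum qs) ⟩
  d + sum Qs ∸ sum qs              ≡⟨ +-∸-assoc d Σqs≤ΣQs ⟩
  d + (sum Qs ∸ sum qs)            ∎
  where open ≡-Reasoning

lower-∷ : ∀ {a e q d Πq ΠQ} → q ≤ a → (a + e) * Πq ≤ a * ΠQ → (a + (d + e)) * (q * Πq) ≤ a * ((q + d) * ΠQ)
lower-∷ {a} {e} {q} {d} {Πq} {ΠQ} q≤a ih = begin
  (a + (d + e)) * (q * Πq)  ≡⟨ cong (_* (q * Πq)) (+.x∙yz≈xz∙y a d e) ⟩
  (a + e + d) * (q * Πq)    ≡⟨ *-assoc (a + e + d) q Πq ⟨
  (a + e + d) * q * Πq      ≤⟨ *-monoˡ-≤ Πq ([m+o]*n≤m*[n+o] d (≤-trans q≤a (m≤m+n a e))) ⟩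
  (a + e) * (q + d) * Πq    ≡⟨ *.xy∙z≈y∙xz (a + e) (q + d) Πq ⟩
  (q + d) * ((a + e) * Πq)  ≤⟨ *-monoʳ-≤ (q + d) ih ⟩
  (q + d) * (a * ΠQ)        ≡⟨ *.x∙yz≈y∙xz (q + d) a ΠQ ⟩
  a * ((q + d) * ΠQ)        ∎
  where open ≤-Reasoning

upper-∷ : ∀ {b e q d Πq ΠQ} → b ≤ q + d → (b ∸ e) * ΠQ ≤ b * Πq → (b ∸ (d + e)) * ((q + d) * ΠQ) ≤ b * (q * Πq)
upper-∷ {b} {e} {q} {d} {Πq} {ΠQ} b≤q+d ih = begin
  (b ∸ (d + e)) * ((q + d) * ΠQ)  ≡⟨ cong (_* ((q + d) * ΠQ)) b∸[d+e]≡b∸e∸d ⟩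
  (b ∸ e ∸ d) * ((q + d) * ΠQ)    ≡⟨ *-assoc (b ∸ e ∸ d) (q + d) ΠQ ⟨
  (b ∸ e ∸ d) * (q + d) * ΠQ      ≤⟨ *-monoˡ-≤ ΠQ ([m∸o]*[n+o]≤m*n d (≤-trans (m∸n≤m b e) b≤q+d)) ⟩
  (b ∸ e) * q * ΠQ                ≡⟨ *.xy∙z≈y∙xz (b ∸ e) q ΠQ ⟩
  q * ((b ∸ e) * ΠQ)              ≤⟨ *-monoʳ-≤ q ih ⟩
  q * (b * Πq)                    ≡⟨ *.x∙yz≈y∙xz q b Πq ⟩
  b * (q * Πq)                    ∎
  where
  open ≤-Reasoning
  b∸[d+e]≡b∸e∸d : b ∸ (d + e) ≡ b ∸ e ∸ d
  b∸[d+e]≡b∸e∸d = trans (cong (b ∸_) (+-comm d e)) (sym (∸-+-assoc b e d))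

Straddles : ℕ → ℕ → ℕ → ℕ → Set
Straddles a b Q q = q ≤ a × b ≤ Q

module _ {a b : ℕ} (a≤b : a ≤ b) where

  straddles⇒≤ : ∀ {Q q} → Straddles a b Q q → q ≤ Q
  straddles⇒≤ (q≤a , b≤Q) = ≤-trans q≤a (≤-trans a≤b b≤Q)

  straddling-sum-≤ : ∀ {Qs qs} → Pointwise (Straddles a b) Qs qs → sum qs ≤ sum Qs
  straddling-sum-≤ []       = z≤n
  straddling-sum-≤ (s ∷ ss) = +-mono-≤ (straddles⇒≤ s) (straddling-sum-≤ ss)

  ell-lower : ∀ {Qs qs} → Pointwise (Straddles a b) Qs qs → (a + ell Qs qs) * product qs ≤ a * product Qs
  ell-lower [] = ≤-reflexive (cong (_* 1) (+-identityʳ a))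
  ell-lower {Q ∷ Qs} {q ∷ qs} (s@(q≤a , _) ∷ ss) with m≤n⇒∃[o]m+o≡n (straddles⇒≤ s)
  ... | d , refl = subst (λ l → (a + l) * (q * product qs) ≤ a * ((q + d) * product Qs))
                         (sym (ell-∷ q d {Qs} {qs} (straddling-sum-≤ ss))) (lower-∷ {e = ell Qs qs} q≤a (ell-lower ss))

  ell-upper : ∀ {Qs qs} → Pointwise (Straddles a b) Qs qs → (b ∸ ell Qs qs) * product Qs ≤ b * product qs
  ell-upper [] = ≤-refl
  ell-upper {Q ∷ Qs} {q ∷ qs} (s@(_ , b≤Q) ∷ ss) with m≤n⇒∃[o]m+o≡n (straddles⇒≤ s)
  ... | d , refl = subst (λ l → (b ∸ l) * ((q + d) * product Qs) ≤ b * (q * product qs))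
                         (sym (ell-∷ q d {Qs} {qs} (straddling-sum-≤ ss))) (upper-∷ {e = ell Qs qs} {q} {d} b≤Q (ell-upper ss))

  value≤frac : ∀ {m Qs qs} → m < b → ell Qs qs ≤ m → 0 < product qs → Pointwise (Straddles a b) Qs qs
    → value Qs qs ≤ℚ frac b (b ∸ m)
  value≤frac {m} {Qs} {qs} m<b ℓ≤m Πq>0 ss = cross-≤⇒frac-≤ Πq>0 (m<n⇒0<n∸m m<b) (begin
    product Qs * (b ∸ m)          ≡⟨ *-comm (product Qs) (b ∸ m) ⟩
    (b ∸ m) * product Qs          ≤⟨ *-monoˡ-≤ (product Qs) (∸-monoʳ-≤ b ℓ≤m) ⟩
    (b ∸ ell Qs qs) * product Qs  ≤⟨ ell-upper ss ⟩
    b * product qs                ∎)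
    where open ≤-Reasoning

  1+frac≤value : ∀ {Qs qs} → 0 < a → 0 < product qs → Pointwise (Straddles a b) Qs qs
    → 1ℚ +ℚ frac (ell Qs qs) a ≤ℚ value Qs qs
  1+frac≤value {Qs} {qs} a>0 Πq>0 ss = subst (_≤ℚ value Qs qs) (sym (1+frac≡frac (ell Qs qs) a a>0))
    (cross-≤⇒frac-≤ a>0 Πq>0 (≤-trans (ell-lower ss) (≤-reflexive (*-comm a (product Qs)))))

primesBelow-suc : ∀ n → primesBelow (suc n) ≡ primesBelow n + length (filter prime? [ n ])
primesBelow-suc n = begin
  length (filter prime? (upTo (suc n)))                   ≡⟨ cong (length ∘ filter prime?) (upTo-∷ʳ n) ⟨
  length (filter prime? (upTo n ++ [ n ]))                ≡⟨ cong length (filter-++ prime? (upTo n) [ n ]) ⟩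
  length (filter prime? (upTo n) ++ filter prime? [ n ])  ≡⟨ length-++ (filter prime? (upTo n)) ⟩
  primesBelow n + length (filter prime? [ n ])            ∎
  where open ≡-Reasoning

primesBelow-suc-prime : ∀ {p} → Prime p → primesBelow (suc p) ≡ suc (primesBelow p)
primesBelow-suc-prime {p} p-prime with prime? p | primesBelow-suc p
... | yes _ | eq = trans eq (+-comm (primesBelow p) 1)
... | no ¬p-prime | _ = ⊥-elim (¬p-prime p-prime)

primesBelow-mono-≤ : ∀ {m n} → m ≤ n → primesBelow m ≤ primesBelow n
primesBelow-mono-≤ = mono′ ∘ ≤⇒≤′
  where
  mono′ : ∀ {m n} → m ≤′ n → primesBelow m ≤ primesBelow n
  mono′ ≤′-refl = ≤-refl
  mono′ (≤′-step {n} m≤′n) =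
    ≤-trans (mono′ m≤′n) (subst (primesBelow n ≤_) (sym (primesBelow-suc n)) (m≤m+n (primesBelow n) _))

primesBelow-prime-< : ∀ {p n} → Prime p → p < n → suc (primesBelow p) ≤ primesBelow n
primesBelow-prime-< p-prime p<n = subst (_≤ _) (primesBelow-suc-prime p-prime) (primesBelow-mono-≤ p<n)

module _ {p p′ : ℕ} (p-prime : Prime p) (p′-next : primesBelow p′ ≡ suc (primesBelow p)) where

  nextPrime-> : p < p′
  nextPrime-> = ≰⇒> λ p′≤p → 1+n≰n (subst (_≤ primesBelow p) p′-next (primesBelow-mono-≤ p′≤p))

  nextPrime-gap : ∀ {q} → Prime q → q < p′ → q ≤ p
  nextPrime-gap q-prime q<p′ = ≮⇒≥ λ p<q → 1+n≰n (subst (suc (suc (primesBelow p)) ≤_) p′-next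
    (≤-trans (s≤s (primesBelow-prime-< p-prime p<q)) (primesBelow-prime-< q-prime q<p′)))

straddling : ∀ {a b Qs qs} → length Qs ≡ length qs → All (b ≤_) Qs → All (_≤ a) qs
  → Pointwise (Straddles a b) Qs qs
straddling _  []             []             = []
straddling eq (b≤Q ∷ b≤Qs)   (q≤a ∷ qs≤a)   = (q≤a , b≤Q) ∷ straddling (suc-injective eq) b≤Qs qs≤a
straddling () []             (_ ∷ _)
straddling () (_ ∷ _)        []

prime>0 : ∀ {p} → Prime p → 0 < p
prime>0 {p} p-prime = >-nonZero⁻¹ p {{prime⇒nonZero p-prime}}

InG⇒value≤frac : ∀ {p P m Qs qs} → p ≤ P → m < P → InG p P m Qs qs → value Qs qs ≤ℚ frac P (P ∸ m)
InG⇒value≤frac p≤P m<P (len , qs-prime , _ , qs≤p , _ , _ , P≤Qs , _ , ℓ≤m) =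
  value≤frac p≤P m<P ℓ≤m (productOfPrimes≥1 qs-prime) (straddling len P≤Qs qs≤p)

InG⇒1+frac≤value : ∀ {p P m Qs qs} → p ≤ P → 0 < p → InG p P m Qs qs → 1ℚ +ℚ frac (ell Qs qs) p ≤ℚ value Qs qs
InG⇒1+frac≤value p≤P p>0 (len , qs-prime , _ , qs≤p , _ , _ , P≤Qs , _) =
  1+frac≤value p≤P p>0 (productOfPrimes≥1 qs-prime) (straddling len P≤Qs qs≤p)

[]∈G : ∀ {p P m} → InG p P m [] []
[]∈G = refl , [] , [] , [] , [] , [] , [] , [] , z≤n

[P]/[q]∈G : ∀ {p P m q} → Prime P → Prime q → 3 ≤ q → q ≤ p → P ∸ q ≤ m → InG p P m [ P ] [ q ]
[P]/[q]∈G {P = P} {q = q} P-prime q-prime 3≤q q≤p P∸q≤m =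
  refl , q-prime ∷ [] , 3≤q ∷ [] , q≤p ∷ [] , [-] , P-prime ∷ [] , ≤-refl ∷ [] , [-] ,
  subst₂ (λ P′ q′ → P′ ∸ q′ ≤ _) (sym (+-identityʳ P)) (sym (+-identityʳ q)) P∸q≤m

-- For q < P the fraction P/q itself lies in 𝒢(p, m), since no prime lies strictly between p and P;
-- for q ≥ P already the empty fraction 1 bounds P/q.
frac≤max : ∀ {p P m q G} → Prime p → primesBelow P ≡ suc (primesBelow p) → Prime P → m + 3 ≤ P
  → (∀ Qs qs → InG p P m Qs qs → value Qs qs ≤ℚ G) → Prime q → P ∸ m ≤ q → frac P q ≤ℚ G
frac≤max {p} {P} {m} {q} p-prime P-next P-prime m+3≤P G-max q-prime P∸m≤q with q <? P
... | yes q<P = ℚ.≤-trans (cross-≤⇒frac-≤ q>0 (*-monoˡ-≤ 1 q>0) (≤-reflexive (*.x∙yz≈xz∙y P q 1)))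
                          (G-max [ P ] [ q ] ([P]/[q]∈G P-prime q-prime 3≤q (nextPrime-gap p-prime P-next q-prime q<P) P∸q≤m))
  where
  q>0 : 0 < q
  q>0 = prime>0 q-prime
  3≤q : 3 ≤ q
  3≤q = ≤-trans (m+n≤o⇒m≤o∸n 3 (subst (_≤ P) (+-comm m 3) m+3≤P)) P∸m≤q
  P∸q≤m : P ∸ q ≤ m
  P∸q≤m = ≤-trans (∸-monoʳ-≤ P P∸m≤q) (≤-reflexive (m∸[m∸n]≡n (m+n≤o⇒m≤o m m+3≤P)))
... | no q≮P = ℚ.≤-trans (cross-≤⇒frac-≤ {c = 1} {d = 1} (prime>0 q-prime) (s≤s z≤n) P*1≤1*q) (G-max [] [] []∈G)
  where
  P*1≤1*q : P * 1 ≤ 1 * q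
  P*1≤1*q = subst (P * 1 ≤_) (*-comm q 1) (*-monoˡ-≤ 1 (≮⇒≥ q≮P))

proposition8 : (k m pk pk1 : ℕ) → 3 ≤ k → IsNthPrime k pk → IsNthPrime (suc k) pk1
    → m + 3 ≤ pk1 → (G : ℚ) → IsMaxG pk pk1 m G
    → ((q : ℕ) → SmallestPrimeAtLeast (pk1 ∸ m) q → frac pk1 q ≤ℚ G)
      × G ≤ℚ frac pk1 (pk1 ∸ m)
      × ((Qs qs : List ℕ) → InG pk pk1 m Qs qs
          → value Qs qs ≤ℚ G × 1ℚ +ℚ frac (ell Qs qs) pk ≤ℚ value Qs qs)
proposition8 _ m pk pk1 _ (pk-prime , pk-index) (pk1-prime , pk1-index) m+3≤pk1 G
             ((_ , _ , F₀∈G , F₀≡G) , G-max) =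
  (λ q (q-prime , pk1∸m≤q , _) → frac≤max pk-prime pk1-next pk1-prime m+3≤pk1 G-max q-prime pk1∸m≤q) ,
  subst (_≤ℚ frac pk1 (pk1 ∸ m)) F₀≡G (InG⇒value≤frac pk≤pk1 m<pk1 F₀∈G) ,
  λ Qs qs F∈G → G-max Qs qs F∈G , InG⇒1+frac≤value pk≤pk1 (prime>0 pk-prime) F∈G
  where
  pk1-next : primesBelow pk1 ≡ suc (primesBelow pk)
  pk1-next = trans (suc-injective pk1-index) (sym pk-index)
  pk≤pk1 : pk ≤ pk1
  pk≤pk1 = <⇒≤ (nextPrime-> pk-prime pk1-next)
  m<pk1 : m < pk1
  m<pk1 = ≤-trans (m<m+n m (s≤s z≤n)) m+3≤pk1
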